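{- For any $n\in\mathbb{N}$, $$E_{2n}(q)=1-\sum_{0<k\le n}(-q;q)_{2k-1}\begin{bmatrix}2n\\2k\end{bmatrix}_qE_{2(n-k)}(q).$$
   Context: For $n\in\mathbb{N}$, $(a;q)_n=\prod_{0\le k<n}(1-aq^k)$ (with $(a;q)_0=1$). For $n,k\in\mathbb{N}$ the $q$-binomial coefficient is $\begin{bmatrix}n\\k\end{bmatrix}_q=\frac{(q;q)_n}{(q;q)_k(q;q)_{n-k}}$ if $k\le n$ and $0$ if $k>n$. The $q$-Euler numbers $E_n(q)$ are defined by $$\sum_{n=0}^{\infty}E_{n}(q)\frac{x^{n}}{(q;q)_{n}}=\Big(\sum_{n=0}^{\infty}\frac{q^{\binom{2n}{2}}x^{2n}}{(q;q)_{2n}}\Big)^{ -1}.$$ -}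

module Defs where

open import Data.Nat using (ℕ; zero; suc; _∸_; _≤ᵇ_)
open import Data.Nat.Combinatorics using (_C_)
open import Data.Bool using (if_then_else_)
open import Data.List using (List; []; _∷_)
open import Algebra.Bundles using (CommutativeRing)

isEven : ℕ → Data.Bool.Bool
isEven zero = Data.Bool.true
isEven (suc n) = Data.Bool.not (isEven n)

-- All definitions live over a commutative ring R, an element q of R, and a
-- family inv of elements; the theorem assumes inv n is the inverse of (q;q)_n,
-- so that the quotients (q;q)_n / ... of the paper make sense
-- (e.g. R = ℚ(q), the field of rational functions, with q the indeterminate).
module QEuler {c ℓ} (R : CommutativeRing c ℓ) (q : CommutativeRing.Carrier R)
              (inv : ℕ → CommutativeRing.Carrier R) where
  open CommutativeRing R

  pow : Carrier → ℕ → Carrier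
  pow x zero = 1#
  pow x (suc n) = pow x n * x

  poch : Carrier → ℕ → Carrier
  poch a zero = 1#
  poch a (suc n) = poch a n * (1# - a * pow q n)

  qq : ℕ → Carrier
  qq n = poch q n

  qbin : ℕ → ℕ → Carrier
  qbin n k = if k ≤ᵇ n then qq n * inv k * inv (n ∸ k) else 0#

  -- coefficient of x^m in  Σ_n q^{binom(2n,2)} x^{2n} / (q;q)_{2n}
  cosCoeff : ℕ → Carrier
  cosCoeff m = if isEven m then pow q (m C 2) * inv m else 0#

  -- Inverse of a power series with constant term 1 (cosCoeff 0 = 1 when inv 0 = 1⁻¹):
  -- b_0 = 1,  b_m = - Σ_{1 ≤ j ≤ m} a_j b_{m-j}.
  -- conv j [b_{m-1}, ..., b_0] = Σ_{i} a_{j+i} b_{m-1-i}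
  conv : ℕ → List Carrier → Carrier
  conv j [] = 0#
  conv j (x ∷ xs) = cosCoeff j * x + conv (suc j) xs

  -- revInv m = [b_m, b_{m-1}, ..., b_0]
  revInv : ℕ → List Carrier
  revInv zero = 1# ∷ []
  revInv (suc m) = (- conv 1 (revInv m)) ∷ revInv m

  invCoeff : ℕ → Carrier
  invCoeff m with revInv m
  ... | [] = 0#
  ... | b ∷ _ = b

  -- q-Euler numbers: Σ E_m x^m/(q;q)_m = (Σ q^{binom(2n,2)} x^{2n}/(q;q)_{2n})^{-1}
  E : ℕ → Carrier
  E m = qq m * invCoeff m

  sum1 : ℕ → (ℕ → Carrier) → Carrier
  sum1 zero f = 0#
  sum1 (suc n) f = sum1 n f + f (suc n)

module Submission where

-- Let cosh_q(x) = Σ x^2n / (q;q)_2n and D(x) = cos_q(x) cosh_q(x).  Writing D_m = d_m / (q;q)_m,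
-- d_m is the sum of [m, i]_q q^(i choose 2) over even i with m - i even, so d_m = 0 for odd m, while
-- for even m = n + 1 Pascal's rule merges the even and odd i and the q-binomial theorem gives
-- d_m = (-q;q)_n.  Since 1/cos_q(x) = Σ E_m x^m / (q;q)_m, multiplying D(x) by it gives
-- cosh_q(x), and comparing coefficients of x^2n / (q;q)_2n yields Σ_k [2n, 2k]_q d_2k E_(2n-2k) = 1,
-- where d_0 = 1.

open import Defs
open import Data.Nat using (ℕ; zero; suc; _*_; _∸_; _≤_; _<_; _≤ᵇ_; z≤n; s≤s)
import Data.Nat as ℕ
import Data.Nat.Properties as ℕₚ
open ℕₚ using (+-suc; *-suc; +-∸-assoc; n∸n≡0; m+[n∸m]≡n; *-distribˡ-∸; *-monoʳ-≤; ≤⇒≤ᵇ; m≤n⇒m≤1+n)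
open import Data.Nat.Combinatorics using (_C_; nC1≡n; nCk+nC[k+1]≡[n+1]C[k+1])
open import Data.Bool using (true; false; not; if_then_else_)
open import Data.Bool.Properties using (not-involutive)
open import Relation.Binary.PropositionalEquality as ≡ using (_≡_)
open import Algebra.Bundles using (CommutativeRing)
import Algebra.Properties.CommutativeSemigroup as CommutativeSemigroupProperties

isEven-+ : ∀ m n → isEven (m ℕ.+ n) ≡ (if isEven m then isEven n else not (isEven n))
isEven-+ zero    n = ≡.refl
isEven-+ (suc m) n rewrite isEven-+ m n with isEven m
... | true  = ≡.refl
... | false = not-involutive (isEven n)

isEven-2* : ∀ k → isEven (2 * k) ≡ true
isEven-2* zero    = ≡.refl
isEven-2* (suc k) = ≡.trans (≡.cong isEven (*-suc 2 k)) (≡.trans (not-involutive _) (isEven-2* k))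

suc-C-2 : ∀ n → suc n C 2 ≡ n C 2 ℕ.+ n
suc-C-2 n = ≡.trans (≡.sym (nCk+nC[k+1]≡[n+1]C[k+1] n 1))
                    (≡.trans (≡.cong (ℕ._+ n C 2) (nC1≡n n)) (ℕₚ.+-comm n (n C 2)))

module CauchyProduct {c ℓ} (R : CommutativeRing c ℓ) where
  open CommutativeRing R renaming (_*_ to _·_)
  open CommutativeSemigroupProperties +-commutativeSemigroup using (interchange)
  open import Relation.Binary.Reasoning.Setoid setoid

  ∑ᵃ : ℕ → (ℕ → ℕ → Carrier) → Carrier
  ∑ᵃ zero    h = h 0 0
  ∑ᵃ (suc m) h = h 0 (suc m) + ∑ᵃ m (λ i j → h (suc i) j)

  infix 5 ∑ᵃ
  syntax ∑ᵃ m (λ i j → e) = ∑[ i + j ≡ m ] e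

  ∑ᵃ-cong : ∀ m {h g : ℕ → ℕ → Carrier} → (∀ i j → i ℕ.+ j ≡ m → h i j ≈ g i j) → ∑ᵃ m h ≈ ∑ᵃ m g
  ∑ᵃ-cong zero    h≈g = h≈g 0 0 ≡.refl
  ∑ᵃ-cong (suc m) h≈g =
    +-cong (h≈g 0 (suc m) ≡.refl) (∑ᵃ-cong m (λ i j i+j≡m → h≈g (suc i) j (≡.cong suc i+j≡m)))

  ∑ᵃ-zero : ∀ m → ∑[ i + j ≡ m ] 0# ≈ 0#
  ∑ᵃ-zero zero    = refl
  ∑ᵃ-zero (suc m) = trans (+-identityˡ _) (∑ᵃ-zero m)

  ∑ᵃ-distrib-+ : ∀ m h g → ∑[ i + j ≡ m ] (h i j + g i j) ≈ ∑ᵃ m h + ∑ᵃ m g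
  ∑ᵃ-distrib-+ zero    h g = refl
  ∑ᵃ-distrib-+ (suc m) h g = trans (+-congˡ (∑ᵃ-distrib-+ m _ _)) (interchange _ _ _ _)

  *-distribˡ-∑ᵃ : ∀ m x h → x · ∑ᵃ m h ≈ ∑[ i + j ≡ m ] (x · h i j)
  *-distribˡ-∑ᵃ zero    x h = refl
  *-distribˡ-∑ᵃ (suc m) x h = trans (distribˡ x _ _) (+-congˡ (*-distribˡ-∑ᵃ m x _))

  *-distribʳ-∑ᵃ : ∀ m x h → ∑ᵃ m h · x ≈ ∑[ i + j ≡ m ] (h i j · x)
  *-distribʳ-∑ᵃ m x h = begin
    ∑ᵃ m h · x                  ≈⟨ *-comm _ x ⟩
    x · ∑ᵃ m h                  ≈⟨ *-distribˡ-∑ᵃ m x h ⟩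
    ∑[ i + j ≡ m ] (x · h i j)  ≈⟨ ∑ᵃ-cong m (λ i j _ → *-comm x (h i j)) ⟩
    ∑[ i + j ≡ m ] (h i j · x)  ∎

  ∑ᵃ-sucʳ : ∀ m h → ∑ᵃ (suc m) h ≈ (∑[ i + j ≡ m ] h i (suc j)) + h (suc m) 0
  ∑ᵃ-sucʳ zero    h = refl
  ∑ᵃ-sucʳ (suc m) h = trans (+-congˡ (∑ᵃ-sucʳ m (λ i j → h (suc i) j))) (sym (+-assoc _ _ _))

  ∑ᵃ-swap : ∀ m h → ∑ᵃ m h ≈ ∑[ i + j ≡ m ] h j i
  ∑ᵃ-swap zero    h = refl
  ∑ᵃ-swap (suc m) h = begin
    h 0 (suc m) + (∑[ i + j ≡ m ] h (suc i) j)  ≈⟨ +-congˡ (∑ᵃ-swap m _) ⟩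
    h 0 (suc m) + (∑[ i + j ≡ m ] h (suc j) i)  ≈⟨ +-comm _ _ ⟩
    (∑[ i + j ≡ m ] h (suc j) i) + h 0 (suc m)  ≈⟨ ∑ᵃ-sucʳ m (λ i j → h j i) ⟨
    ∑[ i + j ≡ suc m ] h j i                    ∎

  ∑ᵃ-assoc : ∀ m (G : ℕ → ℕ → ℕ → Carrier) →
             ∑[ i + j ≡ m ] ∑[ k + l ≡ j ] G i k l ≈ ∑[ s + l ≡ m ] ∑[ i + k ≡ s ] G i k l
  ∑ᵃ-assoc zero    G = refl
  ∑ᵃ-assoc (suc m) G = begin
    ∑ᵃ (suc m) (G 0) + (∑[ i + j ≡ m ] ∑[ k + l ≡ j ] G (suc i) k l)
      ≈⟨ +-congˡ (∑ᵃ-assoc m (λ i → G (suc i))) ⟩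
    (G 0 0 (suc m) + (∑[ k + l ≡ m ] G 0 (suc k) l)) + (∑[ s + l ≡ m ] ∑[ i + k ≡ s ] G (suc i) k l)
      ≈⟨ +-assoc _ _ _ ⟩
    G 0 0 (suc m) + ((∑[ k + l ≡ m ] G 0 (suc k) l) + (∑[ s + l ≡ m ] ∑[ i + k ≡ s ] G (suc i) k l))
      ≈⟨ +-congˡ (∑ᵃ-distrib-+ m _ _) ⟨
    ∑[ s + l ≡ suc m ] ∑[ i + k ≡ s ] G i k l
      ∎

  infixl 7 _⋆_
  infix  4 _≋_

  _⋆_ : (ℕ → Carrier) → (ℕ → Carrier) → ℕ → Carrier
  (f ⋆ g) m = ∑[ i + j ≡ m ] f i · g j

  _≋_ : (ℕ → Carrier) → (ℕ → Carrier) → Set ℓ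
  f ≋ g = ∀ m → f m ≈ g m

  δ : ℕ → Carrier
  δ zero    = 1#
  δ (suc _) = 0#

  ⋆-congˡ : ∀ {f f′} g → f ≋ f′ → f ⋆ g ≋ f′ ⋆ g
  ⋆-congˡ g f≋f′ m = ∑ᵃ-cong m (λ i j _ → *-congʳ (f≋f′ i))

  ⋆-congʳ : ∀ f {g g′} → g ≋ g′ → f ⋆ g ≋ f ⋆ g′
  ⋆-congʳ f g≋g′ m = ∑ᵃ-cong m (λ i j _ → *-congˡ (g≋g′ j))

  ⋆-comm : ∀ f g → f ⋆ g ≋ g ⋆ f
  ⋆-comm f g m = trans (∑ᵃ-swap m _) (∑ᵃ-cong m (λ i j _ → *-comm (f j) (g i)))

  ⋆-assoc : ∀ f g h → (f ⋆ g) ⋆ h ≋ f ⋆ (g ⋆ h)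
  ⋆-assoc f g h m = begin
    ∑[ s + l ≡ m ] ∑ᵃ s (λ i k → f i · g k) · h l
      ≈⟨ ∑ᵃ-cong m (λ s l _ → *-distribʳ-∑ᵃ s (h l) _) ⟩
    ∑[ s + l ≡ m ] ∑[ i + k ≡ s ] (f i · g k) · h l
      ≈⟨ ∑ᵃ-assoc m (λ i k l → (f i · g k) · h l) ⟨
    ∑[ i + j ≡ m ] ∑[ k + l ≡ j ] (f i · g k) · h l
      ≈⟨ ∑ᵃ-cong m (λ i j _ → ∑ᵃ-cong j (λ k l _ → *-assoc (f i) (g k) (h l))) ⟩
    ∑[ i + j ≡ m ] ∑[ k + l ≡ j ] f i · (g k · h l)
      ≈⟨ ∑ᵃ-cong m (λ i j _ → *-distribˡ-∑ᵃ j (f i) _) ⟨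
    ∑[ i + j ≡ m ] f i · ∑ᵃ j (λ k l → g k · h l)
      ∎

  ⋆-identityʳ : ∀ f → f ⋆ δ ≋ f
  ⋆-identityʳ f zero    = *-identityʳ (f 0)
  ⋆-identityʳ f (suc m) =
    trans (+-cong (zeroʳ (f 0)) (⋆-identityʳ (λ i → f (suc i)) m)) (+-identityˡ _)

  ⋆-inverse-cancel : ∀ a b c → a ⋆ b ≋ δ → (a ⋆ c) ⋆ b ≋ c
  ⋆-inverse-cancel a b c a⋆b≋δ m = begin
    ((a ⋆ c) ⋆ b) m  ≈⟨ ⋆-congˡ b (⋆-comm a c) m ⟩
    ((c ⋆ a) ⋆ b) m  ≈⟨ ⋆-assoc c a b m ⟩
    (c ⋆ (a ⋆ b)) m  ≈⟨ ⋆-congʳ c a⋆b≋δ m ⟩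
    (c ⋆ δ) m        ≈⟨ ⋆-identityʳ c m ⟩
    c m              ∎

  ∑ᵃ-even : ∀ n h → (∀ i j → h (suc (2 * i)) j ≈ 0#) → ∑ᵃ (2 * n) h ≈ ∑[ i + j ≡ n ] h (2 * i) (2 * j)
  ∑ᵃ-even zero    h odd = refl
  ∑ᵃ-even (suc n) h odd = begin
    ∑ᵃ (2 * suc n) h
      ≡⟨ ≡.cong (λ m → ∑ᵃ m h) (*-suc 2 n) ⟩
    h 0 (suc (suc (2 * n))) + (h 1 (suc (2 * n)) + (∑[ i + j ≡ 2 * n ] h (suc (suc i)) j))
      ≈⟨ +-congˡ (+-cong (odd 0 _) (∑ᵃ-even n (λ i j → h (suc (suc i)) j) odd′)) ⟩
    h 0 (suc (suc (2 * n))) + (0# + (∑[ i + j ≡ n ] h (suc (suc (2 * i))) (2 * j)))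
      ≈⟨ +-congˡ (+-identityˡ _) ⟩
    h 0 (suc (suc (2 * n))) + (∑[ i + j ≡ n ] h (suc (suc (2 * i))) (2 * j))
      ≈⟨ +-cong (reflexive (≡.cong (h 0) (≡.sym (*-suc 2 n))))
                (∑ᵃ-cong n (λ i j _ → reflexive (≡.cong (λ k → h k (2 * j)) (≡.sym (*-suc 2 i))))) ⟩
    ∑[ i + j ≡ suc n ] h (2 * i) (2 * j)
      ∎
    where
    odd′ : ∀ i j → h (suc (suc (suc (2 * i)))) j ≈ 0#
    odd′ i j = trans (reflexive (≡.cong (λ k → h (suc k) j) (≡.sym (*-suc 2 i)))) (odd (suc i) j)

  evenPart : (ℕ → Carrier) → ℕ → Carrier
  evenPart f m = if isEven m then f m else 0#

  evenPart-·-evenPart-1 : ∀ f i j → evenPart f i · evenPart (λ _ → 1#) j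
                                    ≈ (if isEven (i ℕ.+ j) then evenPart f i else 0#)
  evenPart-·-evenPart-1 f i j rewrite isEven-+ i j with isEven i | isEven j
  ... | true  | true  = *-identityʳ (f i)
  ... | true  | false = zeroʳ (f i)
  ... | false | true  = zeroˡ 1#
  ... | false | false = zeroˡ 0#

module QPochhammer {c ℓ} (R : CommutativeRing c ℓ) (q : CommutativeRing.Carrier R)
  (inv : ℕ → CommutativeRing.Carrier R) where
  open CommutativeRing R renaming (_*_ to _·_)
  open QEuler R q inv
  open import Algebra.Properties.CommutativeSemiring.Exp commutativeSemiring using (_^_; ^-homo-*; ^-distrib-*)
  open CommutativeSemigroupProperties *-commutativeSemigroup using (x∙yz≈xz∙y)
  open import Relation.Binary.Reasoning.Setoid setoid

  pow≈^ : ∀ x n → pow x n ≈ x ^ n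
  pow≈^ x zero    = refl
  pow≈^ x (suc n) = trans (*-congʳ (pow≈^ x n)) (*-comm _ x)

  pow-homo-* : ∀ x m n → pow x (m ℕ.+ n) ≈ pow x m · pow x n
  pow-homo-* x m n = begin
    pow x (m ℕ.+ n)    ≈⟨ pow≈^ x (m ℕ.+ n) ⟩
    x ^ (m ℕ.+ n)      ≈⟨ ^-homo-* x m n ⟩
    x ^ m · x ^ n      ≈⟨ *-cong (pow≈^ x m) (pow≈^ x n) ⟨
    pow x m · pow x n  ∎

  pow-distrib-* : ∀ x y n → pow (x · y) n ≈ pow x n · pow y n
  pow-distrib-* x y n = begin
    pow (x · y) n      ≈⟨ pow≈^ (x · y) n ⟩
    (x · y) ^ n        ≈⟨ ^-distrib-* x y n ⟩
    x ^ n · y ^ n      ≈⟨ *-cong (pow≈^ x n) (pow≈^ y n) ⟨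
    pow x n · pow y n  ∎

  pow-suc-C-2 : ∀ x n → pow x (suc n C 2) ≈ pow x (n C 2) · pow x n
  pow-suc-C-2 x n = trans (reflexive (≡.cong (pow x) (suc-C-2 n))) (pow-homo-* x (n C 2) n)

  poch-cong : ∀ n {a b} → a ≈ b → poch a n ≈ poch b n
  poch-cong zero    a≈b = refl
  poch-cong (suc n) a≈b = *-cong (poch-cong n a≈b) (+-congˡ (-‿cong (*-congʳ a≈b)))

  poch-suc : ∀ n a → poch a (suc n) ≈ (1# - a) · poch (a · q) n
  poch-suc zero    a = begin
    1# · (1# - a · 1#)  ≈⟨ *-identityˡ _ ⟩
    1# - a · 1#         ≈⟨ +-congˡ (-‿cong (*-identityʳ a)) ⟩
    1# - a              ≈⟨ *-identityʳ _ ⟨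
    (1# - a) · 1#       ∎
  poch-suc (suc n) a = begin
    poch a (suc n) · (1# - a · (pow q n · q))
      ≈⟨ *-cong (poch-suc n a) (+-congˡ (-‿cong (x∙yz≈xz∙y a (pow q n) q))) ⟩
    ((1# - a) · poch (a · q) n) · (1# - (a · q) · pow q n)
      ≈⟨ *-assoc _ _ _ ⟩
    (1# - a) · poch (a · q) (suc n)
      ∎

module QEulerProperties {c ℓ} (R : CommutativeRing c ℓ) (q : CommutativeRing.Carrier R)
  (inv : ℕ → CommutativeRing.Carrier R)
  (qq·inv≈1 : ∀ m → CommutativeRing._≈_ R (CommutativeRing._*_ R (QEuler.qq R q inv m) (inv m))
                                          (CommutativeRing.1# R))
  where
  open CommutativeRing R renaming (_*_ to _·_)
  open QEuler R q inv
  open QPochhammer R q inv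
  open CauchyProduct R
  open import Algebra.Properties.Ring ring using (-‿distribˡ-*; -‿involutive; x[y-z]≈xy-xz)
  open CommutativeSemigroupProperties *-commutativeSemigroup using (x∙yz≈y∙xz; x∙yz≈yx∙z; xy∙z≈xz∙y)
  import Algebra.Properties.Group +-group as AdditiveGroupProperties
  open import Algebra.Properties.Quasigroup AdditiveGroupProperties.quasigroup using (x≈z//y)
  open import Algebra.Solver.Ring.NaturalCoefficients.Default commutativeSemiring using (solve; _:=_; _:+_; _:*_)
  open import Relation.Binary.Reasoning.Setoid setoid

  inv0≈1 : inv 0 ≈ 1#
  inv0≈1 = trans (sym (*-identityˡ (inv 0))) (qq·inv≈1 0)

  qbinomial : ℕ → ℕ → Carrier
  qbinomial i j = qq (i ℕ.+ j) · inv i · inv j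

  qbin≡qbinomial : ∀ {n k} → k ≤ n → qbin n k ≡ qbinomial k (n ∸ k)
  qbin≡qbinomial {n} {k} k≤n with k ≤ᵇ n | ≤⇒≤ᵇ k≤n
  ... | true | _ = ≡.cong (λ m → qq m · inv k · inv (n ∸ k)) (≡.sym (m+[n∸m]≡n k≤n))

  qbinomial-zeroˡ : ∀ j → qbinomial 0 j ≈ 1#
  qbinomial-zeroˡ j = begin
    qq j · inv 0 · inv j    ≈⟨ xy∙z≈xz∙y (qq j) (inv 0) (inv j) ⟩
    qq j · inv j · inv 0    ≈⟨ *-cong (qq·inv≈1 j) inv0≈1 ⟩
    1# · 1#                 ≈⟨ *-identityˡ 1# ⟩
    1#                      ∎

  qbinomial-zeroʳ : ∀ i → qbinomial i 0 ≈ 1#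
  qbinomial-zeroʳ i = begin
    qq (i ℕ.+ 0) · inv i · inv 0  ≡⟨ ≡.cong (λ m → qq m · inv i · inv 0) (ℕₚ.+-identityʳ i) ⟩
    qq i · inv i · inv 0          ≈⟨ *-cong (qq·inv≈1 i) inv0≈1 ⟩
    1# · 1#                       ≈⟨ *-identityˡ 1# ⟩
    1#                            ∎

  inv-suc : ∀ n → inv n ≈ (1# - q · pow q n) · inv (suc n)
  inv-suc n = begin
    inv n                                       ≈⟨ *-identityʳ _ ⟨
    inv n · 1#                                  ≈⟨ *-congˡ (qq·inv≈1 (suc n)) ⟨
    inv n · ((qq n · (1# - q · pow q n)) · inv (suc n))
      ≈⟨ solve 4 (λ i Q z j → i :* (Q :* z :* j) := Q :* i :* (z :* j)) refl (inv n) (qq n) (1# - q · pow q n) (inv (suc n)) ⟩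
    (qq n · inv n) · ((1# - q · pow q n) · inv (suc n))
      ≈⟨ *-congʳ (qq·inv≈1 n) ⟩
    1# · ((1# - q · pow q n) · inv (suc n))     ≈⟨ *-identityˡ _ ⟩
    (1# - q · pow q n) · inv (suc n)            ∎

  qbinomial-pascal : ∀ i j → qbinomial (suc i) (suc j) ≈ pow q (suc i) · qbinomial (suc i) j + qbinomial i (suc j)
  qbinomial-pascal i j = begin
    qq (suc i ℕ.+ suc j) · I · J
      ≡⟨ ≡.cong (λ m → qq m · I · J) (+-suc (suc i) j) ⟩
    Q · (1# - q · pow q (suc (i ℕ.+ j))) · I · J
      ≈⟨ solve 4 (λ Q W I J → Q :* W :* I :* J := W :* (Q :* I :* J)) refl Q _ I J ⟩
    (1# - q · pow q (suc (i ℕ.+ j))) · (Q · I · J)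
      ≈⟨ *-congʳ (+-congˡ (-‿cong q·qⁱ⁺ʲ⁺¹)) ⟩
    (1# - (P · q) · (q · P′)) · (Q · I · J)
      ≈⟨ *-congʳ (x[1-y]+[1-x]≈1-xy (P · q) (q · P′)) ⟨
    ((P · q) · (1# - q · P′) + (1# - P · q)) · (Q · I · J)
      ≈⟨ *-congʳ (+-congˡ (+-congˡ (-‿cong (*-comm P q)))) ⟩
    ((P · q) · (1# - q · P′) + (1# - q · P)) · (Q · I · J)
      ≈⟨ solve 7 (λ P q Z′ Z Q I J → (P :* q :* Z′ :+ Z) :* (Q :* I :* J)
                                      := P :* q :* (Q :* I :* (Z′ :* J)) :+ Q :* (Z :* I) :* J)
                 refl P q (1# - q · P′) (1# - q · P) Q I J ⟩
    (P · q) · (Q · I · ((1# - q · P′) · J)) + Q · ((1# - q · P) · I) · J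
      ≈⟨ +-cong (*-congˡ (*-congˡ (inv-suc j))) (*-congʳ (*-congˡ (inv-suc i))) ⟨
    (P · q) · (Q · I · inv j) + Q · inv i · J
      ≡⟨ ≡.cong (λ m → (P · q) · (Q · I · inv j) + qq m · inv i · J) (≡.sym (+-suc i j)) ⟩
    pow q (suc i) · qbinomial (suc i) j + qbinomial i (suc j)
      ∎
    where
    Q  = qq (suc (i ℕ.+ j))
    P  = pow q i
    P′ = pow q j
    I  = inv (suc i)
    J  = inv (suc j)
    q·qⁱ⁺ʲ⁺¹ : q · pow q (suc (i ℕ.+ j)) ≈ (P · q) · (q · P′)
    q·qⁱ⁺ʲ⁺¹ = trans (*-congˡ (*-congʳ (pow-homo-* q i j)))
                     (solve 3 (λ q P P′ → q :* (P :* P′ :* q) := P :* q :* (q :* P′)) refl q P P′)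

    x[1-y]+[1-x]≈1-xy : ∀ x y → x · (1# - y) + (1# - x) ≈ 1# - x · y
    x[1-y]+[1-x]≈1-xy x y = begin
      x · (1# - y) + (1# - x)      ≈⟨ +-congʳ (x[y-z]≈xy-xz x 1# y) ⟩
      (x · 1# - x · y) + (1# - x)  ≈⟨ +-congʳ (+-congʳ (*-identityʳ x)) ⟩
      (x - x · y) + (1# - x)
        ≈⟨ solve 4 (λ x u one v → x :+ u :+ (one :+ v) := x :+ v :+ (one :+ u)) refl x (- (x · y)) 1# (- x) ⟩
      (x - x) + (1# - x · y)       ≈⟨ +-congʳ (-‿inverseʳ x) ⟩
      0# + (1# - x · y)            ≈⟨ +-identityˡ _ ⟩
      1# - x · y                   ∎

  ∑ᵃ-qbinomial-suc : ∀ n (w : ℕ → Carrier) → ∑[ i + j ≡ suc n ] qbinomial i j · w i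
                             ≈ ∑[ i + j ≡ n ] qbinomial i j · (pow q i · w i + w (suc i))
  ∑ᵃ-qbinomial-suc n w = begin
    ∑[ i + j ≡ suc n ] qbinomial i j · w i
      ≈⟨ ∑ᵃ-cong (suc n) split ⟩
    ∑[ i + j ≡ suc n ] (lower i j + upper i j)
      ≈⟨ ∑ᵃ-distrib-+ (suc n) lower upper ⟩
    ∑ᵃ (suc n) lower + ∑ᵃ (suc n) upper
      ≈⟨ +-congʳ (∑ᵃ-sucʳ n lower) ⟩
    ((∑[ i + j ≡ n ] lower i (suc j)) + 0#) + (0# + (∑[ i + j ≡ n ] upper (suc i) j))
      ≈⟨ +-cong (+-identityʳ _) (+-identityˡ _) ⟩
    (∑[ i + j ≡ n ] pow q i · qbinomial i j · w i) + (∑[ i + j ≡ n ] qbinomial i j · w (suc i))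
      ≈⟨ ∑ᵃ-distrib-+ n _ _ ⟨
    ∑[ i + j ≡ n ] (pow q i · qbinomial i j · w i + qbinomial i j · w (suc i))
      ≈⟨ ∑ᵃ-cong n (λ i j _ → regroup (pow q i) (qbinomial i j) (w i) (w (suc i))) ⟩
    ∑[ i + j ≡ n ] qbinomial i j · (pow q i · w i + w (suc i))
      ∎
    where
    -- The two halves of Pascal's rule [n + 1, i]_q = q^i [n, i]_q + [n, i - 1]_q.
    lower upper : ℕ → ℕ → Carrier
    lower i zero    = 0#
    lower i (suc j) = pow q i · qbinomial i j · w i
    upper zero    j = 0#
    upper (suc i) j = qbinomial i j · w (suc i)

    split : ∀ i j → i ℕ.+ j ≡ suc n → qbinomial i j · w i ≈ lower i j + upper i j
    split zero zero ()
    split zero (suc j) _ = begin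
      qbinomial 0 (suc j) · w 0         ≈⟨ *-congʳ (trans (qbinomial-zeroˡ (suc j)) (sym (qbinomial-zeroˡ j))) ⟩
      qbinomial 0 j · w 0               ≈⟨ *-congʳ (*-identityˡ _) ⟨
      1# · qbinomial 0 j · w 0          ≈⟨ +-identityʳ _ ⟨
      1# · qbinomial 0 j · w 0 + 0#     ∎
    split (suc i) zero _ = begin
      qbinomial (suc i) 0 · w (suc i)   ≈⟨ *-congʳ (trans (qbinomial-zeroʳ (suc i)) (sym (qbinomial-zeroʳ i))) ⟩
      qbinomial i 0 · w (suc i)         ≈⟨ +-identityˡ _ ⟨
      0# + qbinomial i 0 · w (suc i)    ∎
    split (suc i) (suc j) _ = trans (*-congʳ (qbinomial-pascal i j)) (distribʳ (w (suc i)) _ _)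

    regroup : ∀ p b x y → p · b · x + b · y ≈ b · (p · x + y)
    regroup = solve 4 (λ p b x y → p :* b :* x :+ b :* y := b :* (p :* x :+ y)) refl

  q-binomial : ∀ n x → ∑[ i + j ≡ n ] qbinomial i j · (pow q (i C 2) · pow x i) ≈ poch (- x) n
  q-binomial zero    x = trans (*-cong (qbinomial-zeroˡ 0) (*-identityˡ 1#)) (*-identityˡ 1#)
  q-binomial (suc n) x = begin
    ∑[ i + j ≡ suc n ] qbinomial i j · w x i
      ≈⟨ ∑ᵃ-qbinomial-suc n (w x) ⟩
    ∑[ i + j ≡ n ] qbinomial i j · (pow q i · w x i + w x (suc i))
      ≈⟨ ∑ᵃ-cong n (λ i j _ → trans (*-congˡ (step i)) (x∙yz≈y∙xz _ _ _)) ⟩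
    ∑[ i + j ≡ n ] (1# + x) · (qbinomial i j · w (q · x) i)
      ≈⟨ *-distribˡ-∑ᵃ n (1# + x) _ ⟨
    (1# + x) · (∑[ i + j ≡ n ] qbinomial i j · w (q · x) i)
      ≈⟨ *-congˡ (q-binomial n (q · x)) ⟩
    (1# + x) · poch (- (q · x)) n
      ≈⟨ *-cong (+-congˡ (-‿involutive x)) (poch-cong n (trans (sym (-‿distribˡ-* x q)) (-‿cong (*-comm x q)))) ⟨
    (1# - - x) · poch (- x · q) n
      ≈⟨ poch-suc n (- x) ⟨
    poch (- x) (suc n)
      ∎
    where
    w : Carrier → ℕ → Carrier
    w y i = pow q (i C 2) · pow y i

    step : ∀ i → pow q i · w x i + w x (suc i) ≈ (1# + x) · w (q · x) i
    step i = begin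
      pow q i · (T · X) + pow q (suc i C 2) · (X · x)
        ≈⟨ +-congˡ (*-congʳ (pow-suc-C-2 q i)) ⟩
      Q · (T · X) + (T · Q) · (X · x)
        ≈⟨ solve 4 (λ Q T X x → Q :* (T :* X) :+ T :* Q :* (X :* x) := T :* (Q :* X) :+ x :* (T :* (Q :* X)))
                   refl Q T X x ⟩
      T · (Q · X) + x · (T · (Q · X))
        ≈⟨ +-congʳ (*-identityˡ _) ⟨
      1# · (T · (Q · X)) + x · (T · (Q · X))
        ≈⟨ distribʳ _ 1# x ⟨
      (1# + x) · (T · (Q · X))
        ≈⟨ *-congˡ (*-congˡ (pow-distrib-* q x i)) ⟨
      (1# + x) · w (q · x) i
        ∎
      where
      Q = pow q i
      T = pow q (i C 2)
      X = pow x i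

  qq-+·≈qbinomial· : ∀ i j x y → qq (i ℕ.+ j) · (x · y) ≈ qbinomial i j · ((qq i · x) · (qq j · y))
  qq-+·≈qbinomial· i j x y = begin
    qq (i ℕ.+ j) · (x · y)                                ≈⟨ *-identityʳ _ ⟨
    qq (i ℕ.+ j) · (x · y) · 1#                           ≈⟨ *-congˡ (*-identityʳ 1#) ⟨
    qq (i ℕ.+ j) · (x · y) · (1# · 1#)                    ≈⟨ *-congˡ (*-cong (qq·inv≈1 i) (qq·inv≈1 j)) ⟨
    qq (i ℕ.+ j) · (x · y) · ((qq i · inv i) · (qq j · inv j))
      ≈⟨ solve 7 (λ N x y A I B J → N :* (x :* y) :* (A :* I :* (B :* J)) := N :* I :* J :* (A :* x :* (B :* y)))
                 refl (qq (i ℕ.+ j)) x y (qq i) (inv i) (qq j) (inv j) ⟩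
    qbinomial i j · ((qq i · x) · (qq j · y))             ∎

  qq·⋆ : ∀ f g m → qq m · (f ⋆ g) m ≈ ∑[ i + j ≡ m ] qbinomial i j · ((qq i · f i) · (qq j · g j))
  qq·⋆ f g m = trans (*-distribˡ-∑ᵃ m (qq m) _) (∑ᵃ-cong m term)
    where
    term : ∀ i j → i ℕ.+ j ≡ m → qq m · (f i · g j) ≈ qbinomial i j · ((qq i · f i) · (qq j · g j))
    term i j i+j≡m = trans (reflexive (≡.cong (λ k → qq k · (f i · g j)) (≡.sym i+j≡m)))
                           (qq-+·≈qbinomial· i j (f i) (g j))

  coshCoeff : ℕ → Carrier
  coshCoeff = evenPart inv

  cosEulerian : ℕ → Carrier
  cosEulerian = evenPart (λ k → pow q (k C 2))

  qq·cosCoeff : ∀ m → qq m · cosCoeff m ≈ cosEulerian m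
  qq·cosCoeff m with isEven m
  ... | true  = trans (x∙yz≈y∙xz (qq m) _ _) (trans (*-congˡ (qq·inv≈1 m)) (*-identityʳ _))
  ... | false = zeroʳ (qq m)

  qq·coshCoeff : ∀ m → qq m · coshCoeff m ≈ evenPart (λ _ → 1#) m
  qq·coshCoeff m with isEven m
  ... | true  = qq·inv≈1 m
  ... | false = zeroʳ (qq m)

  cosEulerian-step : ∀ i → pow q i · cosEulerian i + cosEulerian (suc i) ≈ pow q (i C 2) · pow q i
  cosEulerian-step i with isEven i
  ... | true  = trans (+-identityʳ _) (*-comm _ _)
  ... | false = trans (+-congʳ (zeroʳ _)) (trans (+-identityˡ _) (pow-suc-C-2 q i))

  cosCoeff-zero : cosCoeff 0 ≈ 1#
  cosCoeff-zero = trans (*-identityˡ (inv 0)) inv0≈1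

  conv≈∑ᵃ : ∀ m j → conv j (revInv m) ≈ ∑[ i + k ≡ m ] cosCoeff (j ℕ.+ i) · invCoeff k
  conv≈∑ᵃ zero    j = trans (+-identityʳ _) (reflexive (≡.cong (λ t → cosCoeff t · 1#) (≡.sym (ℕₚ.+-identityʳ j))))
  conv≈∑ᵃ (suc m) j =
    +-cong (reflexive (≡.cong (λ t → cosCoeff t · invCoeff (suc m)) (≡.sym (ℕₚ.+-identityʳ j))))
           (trans (conv≈∑ᵃ m (suc j))
                  (∑ᵃ-cong m (λ i k _ → reflexive (≡.cong (λ t → cosCoeff t · invCoeff k) (≡.sym (+-suc j i))))))

  cosCoeff⋆invCoeff : cosCoeff ⋆ invCoeff ≋ δ
  cosCoeff⋆invCoeff zero    = trans (*-identityʳ _) cosCoeff-zero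
  cosCoeff⋆invCoeff (suc m) = begin
    cosCoeff 0 · - conv 1 (revInv m) + X  ≈⟨ +-congʳ (*-cong cosCoeff-zero (-‿cong (conv≈∑ᵃ m 1))) ⟩
    1# · - X + X                          ≈⟨ +-congʳ (*-identityˡ _) ⟩
    - X + X                               ≈⟨ -‿inverseˡ X ⟩
    0#                                    ∎
    where
    X = ∑[ i + k ≡ m ] cosCoeff (suc i) · invCoeff k

  cosCosh : ℕ → Carrier
  cosCosh = cosCoeff ⋆ coshCoeff

  qq·cosCosh : ∀ m {b} → isEven m ≡ b →
               qq m · cosCosh m ≈ ∑[ i + j ≡ m ] qbinomial i j · (if b then cosEulerian i else 0#)
  qq·cosCosh m {b} m-parity = trans (qq·⋆ cosCoeff coshCoeff m) (∑ᵃ-cong m term)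
    where
    term : ∀ i j → i ℕ.+ j ≡ m → qbinomial i j · ((qq i · cosCoeff i) · (qq j · coshCoeff j))
                                ≈ qbinomial i j · (if b then cosEulerian i else 0#)
    term i j i+j≡m = *-congˡ (begin
      (qq i · cosCoeff i) · (qq j · coshCoeff j)
        ≈⟨ *-cong (qq·cosCoeff i) (qq·coshCoeff j) ⟩
      cosEulerian i · evenPart (λ _ → 1#) j
        ≈⟨ evenPart-·-evenPart-1 (λ k → pow q (k C 2)) i j ⟩
      (if isEven (i ℕ.+ j) then cosEulerian i else 0#)
        ≡⟨ ≡.cong (λ b → if b then cosEulerian i else 0#) (≡.trans (≡.cong isEven i+j≡m) m-parity) ⟩
      (if b then cosEulerian i else 0#)
        ∎)

  qq·cosCosh-zero : qq 0 · cosCosh 0 ≈ 1#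
  qq·cosCosh-zero = trans (qq·cosCosh 0 ≡.refl) (trans (*-identityʳ _) (qbinomial-zeroˡ 0))

  qq·cosCosh-odd : ∀ m → isEven m ≡ false → qq m · cosCosh m ≈ 0#
  qq·cosCosh-odd m odd = trans (qq·cosCosh m odd) (trans (∑ᵃ-cong m (λ i j _ → zeroʳ _)) (∑ᵃ-zero m))

  qq·cosCosh-even : ∀ n → isEven (suc n) ≡ true → qq (suc n) · cosCosh (suc n) ≈ poch (- q) n
  qq·cosCosh-even n even = begin
    qq (suc n) · cosCosh (suc n)
      ≈⟨ qq·cosCosh (suc n) even ⟩
    ∑[ i + j ≡ suc n ] qbinomial i j · cosEulerian i
      ≈⟨ ∑ᵃ-qbinomial-suc n cosEulerian ⟩
    ∑[ i + j ≡ n ] qbinomial i j · (pow q i · cosEulerian i + cosEulerian (suc i))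
      ≈⟨ ∑ᵃ-cong n (λ i j _ → *-congˡ (cosEulerian-step i)) ⟩
    ∑[ i + j ≡ n ] qbinomial i j · (pow q (i C 2) · pow q i)
      ≈⟨ q-binomial n q ⟩
    poch (- q) n
      ∎

  coshCoeff≈cosCosh⋆invCoeff : coshCoeff ≋ cosCosh ⋆ invCoeff
  coshCoeff≈cosCosh⋆invCoeff m = sym (⋆-inverse-cancel cosCoeff invCoeff coshCoeff cosCoeff⋆invCoeff m)

  sum1-cong : ∀ n {f g} → (∀ {k} → 0 < k → k ≤ n → f k ≈ g k) → sum1 n f ≈ sum1 n g
  sum1-cong zero    f≈g = refl
  sum1-cong (suc n) f≈g = +-cong (sum1-cong n (λ 0<k k≤n → f≈g 0<k (m≤n⇒m≤1+n k≤n))) (f≈g (s≤s z≤n) ℕₚ.≤-refl)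

  ∑ᵃ≈sum1 : ∀ n h → ∑ᵃ n h ≈ h 0 n + sum1 n (λ k → h k (n ∸ k))
  ∑ᵃ≈sum1 zero    h = sym (+-identityʳ _)
  ∑ᵃ≈sum1 (suc n) h = begin
    ∑ᵃ (suc n) h
      ≈⟨ ∑ᵃ-sucʳ n h ⟩
    (∑[ i + j ≡ n ] h i (suc j)) + h (suc n) 0
      ≈⟨ +-congʳ (∑ᵃ≈sum1 n (λ i j → h i (suc j))) ⟩
    (h 0 (suc n) + sum1 n (λ k → h k (suc (n ∸ k)))) + h (suc n) 0
      ≈⟨ +-assoc _ _ _ ⟩
    h 0 (suc n) + (sum1 n (λ k → h k (suc (n ∸ k))) + h (suc n) 0)
      ≈⟨ +-congˡ (+-cong (sum1-cong n (λ _ k≤n → reflexive (≡.cong (h _) (≡.sym (+-∸-assoc 1 k≤n)))))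
                         (reflexive (≡.cong (h (suc n)) (≡.sym (n∸n≡0 n))))) ⟩
    h 0 (suc n) + sum1 (suc n) (λ k → h k (suc n ∸ k))
      ∎

  eulerianTerm : ℕ → ℕ → Carrier
  eulerianTerm i j = qbinomial i j · ((qq i · cosCosh i) · E j)

  ∑ᵃ-eulerianTerm : ∀ m → ∑ᵃ m eulerianTerm ≈ qq m · coshCoeff m
  ∑ᵃ-eulerianTerm m = begin
    ∑ᵃ m eulerianTerm               ≈⟨ qq·⋆ cosCosh invCoeff m ⟨
    qq m · (cosCosh ⋆ invCoeff) m   ≈⟨ *-congˡ (coshCoeff≈cosCosh⋆invCoeff m) ⟨
    qq m · coshCoeff m              ∎

  eulerianTerm-odd : ∀ i j → eulerianTerm (suc (2 * i)) j ≈ 0#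
  eulerianTerm-odd i j =
    trans (*-congˡ (trans (*-congʳ (qq·cosCosh-odd _ (≡.cong not (isEven-2* i)))) (zeroˡ _))) (zeroʳ _)

  eulerianTerm-zero : ∀ j → eulerianTerm 0 j ≈ E j
  eulerianTerm-zero j = begin
    qbinomial 0 j · ((qq 0 · cosCosh 0) · E j)  ≈⟨ *-cong (qbinomial-zeroˡ j) (*-congʳ qq·cosCosh-zero) ⟩
    1# · (1# · E j)                              ≈⟨ trans (*-identityˡ _) (*-identityˡ _) ⟩
    E j                                          ∎

  eulerianTerm-even : ∀ {n k} → 0 < k → k ≤ n →
                      eulerianTerm (2 * k) (2 * (n ∸ k)) ≈ (poch (- q) (2 * k ∸ 1) · qbin (2 * n) (2 * k)) · E (2 * (n ∸ k))
  eulerianTerm-even {n} {suc k} _ k≤n = begin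
    qbinomial (2 * suc k) (2 * (n ∸ suc k)) · ((qq (2 * suc k) · cosCosh (2 * suc k)) · E (2 * (n ∸ suc k)))
      ≈⟨ *-cong (reflexive qbinomial≡qbin) (*-congʳ (qq·cosCosh-even (2 * suc k ∸ 1) (isEven-2* (suc k)))) ⟩
    qbin (2 * n) (2 * suc k) · (poch (- q) (2 * suc k ∸ 1) · E (2 * (n ∸ suc k)))
      ≈⟨ x∙yz≈yx∙z _ _ _ ⟩
    (poch (- q) (2 * suc k ∸ 1) · qbin (2 * n) (2 * suc k)) · E (2 * (n ∸ suc k))
      ∎
    where
    qbinomial≡qbin : qbinomial (2 * suc k) (2 * (n ∸ suc k)) ≡ qbin (2 * n) (2 * suc k)
    qbinomial≡qbin = ≡.trans (≡.cong (qbinomial (2 * suc k)) (*-distribˡ-∸ 2 n (suc k)))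
                             (≡.sym (qbin≡qbinomial (*-monoʳ-≤ 2 k≤n)))

  E-recurrence : ∀ n → E (2 * n) ≈ 1# - sum1 n (λ k → (poch (- q) (2 * k ∸ 1) · qbin (2 * n) (2 * k)) · E (2 * (n ∸ k)))
  E-recurrence n = x≈z//y _ _ _ (begin
    E (2 * n) + sum1 n summand
      ≈⟨ +-cong (eulerianTerm-zero (2 * n)) (sum1-cong n eulerianTerm-even) ⟨
    eulerianTerm 0 (2 * n) + sum1 n (λ k → eulerianTerm (2 * k) (2 * (n ∸ k)))
      ≈⟨ ∑ᵃ≈sum1 n (λ k l → eulerianTerm (2 * k) (2 * l)) ⟨
    ∑[ k + l ≡ n ] eulerianTerm (2 * k) (2 * l)
      ≈⟨ ∑ᵃ-even n eulerianTerm eulerianTerm-odd ⟨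
    ∑ᵃ (2 * n) eulerianTerm
      ≈⟨ ∑ᵃ-eulerianTerm (2 * n) ⟩
    qq (2 * n) · coshCoeff (2 * n)
      ≡⟨ ≡.cong (λ b → qq (2 * n) · (if b then inv (2 * n) else 0#)) (isEven-2* n) ⟩
    qq (2 * n) · inv (2 * n)
      ≈⟨ qq·inv≈1 (2 * n) ⟩
    1#
      ∎)
    where
    summand : ℕ → Carrier
    summand k = (poch (- q) (2 * k ∸ 1) · qbin (2 * n) (2 * k)) · E (2 * (n ∸ k))

lemma2p1 : ∀ {c ℓ} (R : CommutativeRing c ℓ) (q : CommutativeRing.Carrier R)
             (inv : ℕ → CommutativeRing.Carrier R) →
             (∀ m → CommutativeRing._≈_ R (CommutativeRing._*_ R (QEuler.qq R q inv m) (inv m)) (CommutativeRing.1# R)) →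
             (n : ℕ) →
             CommutativeRing._≈_ R (QEuler.E R q inv (2 * n))
               (CommutativeRing._-_ R (CommutativeRing.1# R)
                 (QEuler.sum1 R q inv n (λ k →
                   CommutativeRing._*_ R
                     (CommutativeRing._*_ R
                       (QEuler.poch R q inv (CommutativeRing.-_ R q) (2 * k ∸ 1))
                       (QEuler.qbin R q inv (2 * n) (2 * k)))
                     (QEuler.E R q inv (2 * (n ∸ k))))))
lemma2p1 R q inv qq·inv≈1 = QEulerProperties.E-recurrence R q inv qq·inv≈1
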